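{- Let $n\geq1$ and let $f_1,\ldots,f_n\in\omega^\omega$ be pairwise Turing-incomparable. Suppose $\mathcal{C}\subseteq\omega^\omega$ is a mass problem with $\mathcal{C}\geq_M\{f_1,\ldots,f_n\}$ and, for some $i\in\{1,\ldots,n\}$, $\mathcal{C}\not\geq_M\{f_i\}'\times\{f_j:j\neq i\}$. Then $\mathcal{C}\leq_M\{f_i\}$.
   Context: A mass problem is a subset of $\omega^\omega$. $\mathcal{A}\leq_M\mathcal{B}$ means there is a partial computable functional $\Psi$ defined on all of $\mathcal{B}$ with $\Psi(\mathcal{B})\subseteq\mathcal{A}$. For $n\in\omega$, $n\,\widehat{\ }\,\mathcal{A}=\{n\,\widehat{\ }\,f:f\in\mathcal{A}\}$ ($\widehat{\ }$ = concatenation) and $\mathcal{A}\times\mathcal{B}=0\,\widehat{\ }\,\mathcal{A}\cup1\,\widehat{\ }\,\mathcal{B}$. For $f\in\omega^\omega$, $\{f\}'=\{n\,\widehat{\ }\,g: f<_T g\wedge\Phi_n(g)=f\}$, where $\Phi_n$ is the $n$-th partial computable functional and $<_T$ is strict Turing reducibility. -}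

module Defs where

open import Data.Nat using (ℕ; zero; suc; _<_)
open import Data.Fin using (Fin)
open import Data.Vec using (Vec; []; _∷_; lookup)
open import Data.Product using (Σ; _×_; _,_; proj₁; proj₂)
open import Data.Sum using (_⊎_)
open import Relation.Binary.PropositionalEquality using (_≡_; _≢_)
open import Relation.Nullary using (¬_)

Baire : Set
Baire = ℕ → ℕ

MassProblem : Set₁
MassProblem = Baire → Set

_≈_ : Baire → Baire → Set
f ≈ g = ∀ x → f x ≡ g x

_⌢_ : ℕ → Baire → Baire
(n ⌢ f) zero    = n
(n ⌢ f) (suc x) = f x

tail : Baire → Baire
tail h x = h (suc x)

-- Oracle partial recursive functions (Kleene-style codes).
-- Code k : codes for k-ary partial functions computable relative to an
-- oracle g ∈ ω^ω.

data Code : ℕ → Set where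
  Z : ∀ {k} → Code k
  S : Code 1
  P : ∀ {k} → Fin k → Code k
  O : Code 1
  C : ∀ {k m} → Code m → Vec (Code k) m → Code k
  R : ∀ {k} → Code k → Code (suc (suc k)) → Code (suc k)
  M : ∀ {k} → Code (suc k) → Code k

-- Big-step semantics: Eval g c xs y  means  c^g(xs) converges with value y.
mutual
  data Eval (g : Baire) : ∀ {k} → Code k → Vec ℕ k → ℕ → Set where
    ev-Z : ∀ {k} {xs : Vec ℕ k} → Eval g Z xs 0
    ev-S : ∀ {x} → Eval g S (x ∷ []) (suc x)
    ev-P : ∀ {k} {i : Fin k} {xs} → Eval g (P i) xs (lookup xs i)
    ev-O : ∀ {x} → Eval g O (x ∷ []) (g x)
    ev-C : ∀ {k m} {f : Code m} {hs : Vec (Code k) m} {xs ys y} →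
           EvalVec g hs xs ys → Eval g f ys y → Eval g (C f hs) xs y
    ev-R0 : ∀ {k} {b : Code k} {s xs y} →
            Eval g b xs y → Eval g (R b s) (0 ∷ xs) y
    ev-RS : ∀ {k} {b : Code k} {s n xs y z} →
            Eval g (R b s) (n ∷ xs) y → Eval g s (n ∷ y ∷ xs) z →
            Eval g (R b s) (suc n ∷ xs) z
    ev-M : ∀ {k} {f : Code (suc k)} {xs y} →
           Eval g f (y ∷ xs) 0 →
           (∀ i → i < y → Σ ℕ λ v → Eval g f (i ∷ xs) (suc v)) →
           Eval g (M f) xs y

  data EvalVec (g : Baire) : ∀ {k m} → Vec (Code k) m → Vec ℕ k → Vec ℕ m → Set where
    ev-[] : ∀ {k} {xs : Vec ℕ k} → EvalVec g [] xs []
    ev-∷  : ∀ {k m} {h : Code k} {hs : Vec (Code k) m} {xs y ys} →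
            Eval g h xs y → EvalVec g hs xs ys → EvalVec g (h ∷ hs) xs (y ∷ ys)

-- Gödel numbering: a total, effective decoding ℕ → Code k
-- (surjective), via the Cantor enumeration of ℕ × ℕ.

unpair : ℕ → ℕ × ℕ
unpair zero = (0 , 0)
unpair (suc n) with unpair n
... | (zero  , b) = (suc b , 0)
... | (suc a , b) = (a , suc b)

toFin : (k : ℕ) → ℕ → Fin (suc k)
toFin zero    _       = Fin.zero
toFin (suc k) zero    = Fin.zero
toFin (suc k) (suc r) = Fin.suc (toFin k r)

codeS : (k : ℕ) → Code k
codeS 1 = S
codeS _ = Z

codeO : (k : ℕ) → Code k
codeO 1 = O
codeO _ = Z

mutual
  decode : ℕ → (k : ℕ) → ℕ → Code k
  decode zero       k n = Z
  decode (suc fuel) k n = byTag fuel k (proj₁ (unpair n)) (proj₂ (unpair n))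

  byTag : ℕ → (k : ℕ) → ℕ → ℕ → Code k
  byTag fuel k 0 r = Z
  byTag fuel k 1 r = codeS k
  byTag fuel zero 2 r = Z
  byTag fuel (suc k) 2 r = P (toFin k r)
  byTag fuel k 3 r = codeO k
  byTag fuel k 4 r =
    C (decode fuel (proj₁ (unpair r)) (proj₁ (unpair (proj₂ (unpair r)))))
      (decodeVec fuel k (proj₁ (unpair r)) (proj₂ (unpair (proj₂ (unpair r)))))
  byTag fuel zero 5 r = Z
  byTag fuel (suc k) 5 r =
    R (decode fuel k (proj₁ (unpair r))) (decode fuel (suc (suc k)) (proj₂ (unpair r)))
  byTag fuel k 6 r = M (decode fuel (suc k) r)
  byTag fuel k _ r = Z

  decodeVec : ℕ → (k m : ℕ) → ℕ → Vec (Code k) m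
  decodeVec fuel k zero    d = []
  decodeVec fuel k (suc m) d =
    decode fuel k (proj₁ (unpair d)) ∷ decodeVec fuel k m (proj₂ (unpair d))

code : ℕ → Code 1
code e = decode e 1 e

-- Partial computable functionals Φ_e : ω^ω ⇀ ω^ω.
-- Φ e g h : Φ_e(g) is total and equals h.

Φ : ℕ → Baire → Baire → Set
Φ e g h = ∀ m → Eval g (code e) (m ∷ []) (h m)

_≤T_ : Baire → Baire → Set
f ≤T g = Σ ℕ λ e → Φ e g f

_<T_ : Baire → Baire → Set
f <T g = f ≤T g × ¬ (g ≤T f)

_≤M_ : MassProblem → MassProblem → Set
A ≤M B = Σ ℕ λ e → ∀ g → B g → Σ Baire λ h → Φ e g h × A h

Single : Baire → MassProblem
Single f g = g ≈ f

FinSet : ∀ {n} → (Fin n → Baire) → MassProblem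
FinSet f g = Σ _ λ k → g ≈ f k

Others : ∀ {n} → (Fin n → Baire) → Fin n → MassProblem
Others f i g = Σ _ λ j → j ≢ i × g ≈ f j

_⌢M_ : ℕ → MassProblem → MassProblem
(n ⌢M A) h = h 0 ≡ n × A (tail h)

_×M_ : MassProblem → MassProblem → MassProblem
(A ×M B) h = (0 ⌢M A) h ⊎ (1 ⌢M B) h

Jump : Baire → MassProblem
Jump f h = f <T tail h × Φ (h 0) (tail h) f

{-# OPTIONS --safe #-}
-- Classically, either 𝒞 ≤M {f i} and we are done, or no member of 𝒞 is computable from f i.
-- In the latter case each g ∈ 𝒞 computes h = Φ_e(g) ∈ {f_1, …, f_n}, where e is the given
-- reduction. As the f_k are pairwise distinct, comparing h with f i at finitely many fixed
-- separating points decides uniformly whether h = f i. If it does, then 0⌢e⌢g ∈ {f i}′, since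
-- g computes f i via e while g ≰T f i; otherwise 1⌢h ∈ {f_j : j ≠ i}. This procedure reduces
-- the product to 𝒞.
module Submission where

open import Defs
open import Level using (0ℓ)
open import Axiom.ExcludedMiddle using (ExcludedMiddle)
open import Data.Nat using (ℕ; zero; suc; _+_; _∸_; ∣_-_∣; pred; _≤_; _<_; z≤n; s≤s) renaming (_≟_ to _≟ℕ_)
open import Data.Nat.Properties
  using (+-suc; +-identityʳ; suc-injective; m≤m+n; m≤n+m; ≤-trans; ≤-refl; ≤-pred; pred[m∸n]≡m∸[1+n];
         m+n≡0⇒m≡0; m+n≡0⇒n≡0; ∣m-n∣≡0⇒m≡n; m≡n⇒∣m-n∣≡0)
open import Data.Fin using (Fin; toℕ; _≟_)
open import Data.Vec using (Vec; []; _∷_)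
open import Data.Product using (Σ; _×_; _,_; proj₁; proj₂)
open import Data.Sum using (inj₁; inj₂)
open import Data.Empty using (⊥-elim)
open import Function using (_∘_)
open import Relation.Nullary using (¬_; yes; no)
open import Relation.Nullary.Decidable using (decidable-stable)
open import Relation.Binary.PropositionalEquality using (_≡_; _≢_; refl; sym; trans; cong; cong₂; subst)

triangle : ℕ → ℕ
triangle zero    = 0
triangle (suc s) = triangle s + suc s

unpair-suc-zero : ∀ n {b} → unpair n ≡ (0 , b) → unpair (suc n) ≡ (suc b , 0)
unpair-suc-zero n eq rewrite eq = refl

unpair-suc-suc : ∀ n {a b} → unpair n ≡ (suc a , b) → unpair (suc n) ≡ (a , suc b)
unpair-suc-suc n eq rewrite eq = refl

-- pair is the inverse of the Cantor enumeration unpair, which walks the diagonal a + b = s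
-- starting at position triangle s. It is opaque so that unification never unfolds it.
opaque
  pair : ℕ → ℕ → ℕ
  pair a b = triangle (a + b) + b

  pair-suc-zero : ∀ a → pair (suc a) 0 ≡ suc (pair 0 a)
  pair-suc-zero a rewrite +-identityʳ a | +-identityʳ (triangle a + suc a) = +-suc (triangle a) a

  pair-suc : ∀ a b → pair a (suc b) ≡ suc (pair (suc a) b)
  pair-suc a b rewrite +-suc a b = +-suc (triangle (suc (a + b))) b

  unpair-pair-diagonal : ∀ s a b → a + b ≡ s → unpair (pair a b) ≡ (a , b)
  unpair-pair-diagonal s a (suc b) a+b≡s rewrite pair-suc a b =
    unpair-suc-suc (pair (suc a) b) (unpair-pair-diagonal s (suc a) b (trans (sym (+-suc a b)) a+b≡s))
  unpair-pair-diagonal s zero zero _ = refl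
  unpair-pair-diagonal (suc s) (suc a) zero a+0≡s rewrite pair-suc-zero a =
    unpair-suc-zero (pair 0 a)
      (unpair-pair-diagonal s zero a (trans (sym (+-identityʳ a)) (suc-injective a+0≡s)))

  unpair-pair : ∀ a b → unpair (pair a b) ≡ (a , b)
  unpair-pair a b = unpair-pair-diagonal (a + b) a b refl

  +≤pair : ∀ a b → a + b ≤ pair a b
  +≤pair a b = ≤-trans (n≤triangle (a + b)) (m≤m+n (triangle (a + b)) b)
    where
    n≤triangle : ∀ n → n ≤ triangle n
    n≤triangle zero    = z≤n
    n≤triangle (suc n) = m≤n+m (suc n) (triangle n)

  fst≤pair : ∀ a b → a ≤ pair a b
  fst≤pair a b = ≤-trans (m≤m+n a b) (+≤pair a b)

  snd≤pair : ∀ a b → b ≤ pair a b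
  snd≤pair a b = ≤-trans (m≤n+m b a) (+≤pair a b)

  snd<pair-suc : ∀ a b → b < pair (suc a) b
  snd<pair-suc a b = ≤-trans (s≤s (m≤n+m b a)) (+≤pair (suc a) b)

mutual
  encode : ∀ {k} → Code k → ℕ
  encode Z                  = 0
  encode S                  = pair 1 0
  encode (P i)              = pair 2 (toℕ i)
  encode O                  = pair 3 0
  encode (C {m = m} f hs)   = pair 4 (pair m (pair (encode f) (encodeVec hs)))
  encode (R b s)            = pair 5 (pair (encode b) (encode s))
  encode (M f)              = pair 6 (encode f)

  encodeVec : ∀ {k m} → Vec (Code k) m → ℕ
  encodeVec []       = 0
  encodeVec (h ∷ hs) = pair (encode h) (encodeVec hs)

decode-pair : ∀ fuel k t r → decode (suc fuel) k (pair t r) ≡ byTag fuel k t r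
decode-pair fuel k t r rewrite unpair-pair t r = refl

decodeVec-pair : ∀ fuel k m a d →
  decodeVec fuel k (suc m) (pair a d) ≡ decode fuel k a ∷ decodeVec fuel k m d
decodeVec-pair fuel k m a d rewrite unpair-pair a d = refl

byTag-C : ∀ fuel k m a d →
  byTag fuel k 4 (pair m (pair a d)) ≡ C (decode fuel m a) (decodeVec fuel k m d)
byTag-C fuel zero    m a d rewrite unpair-pair m (pair a d) | unpair-pair a d = refl
byTag-C fuel (suc k) m a d rewrite unpair-pair m (pair a d) | unpair-pair a d = refl

byTag-R : ∀ fuel k a d →
  byTag fuel (suc k) 5 (pair a d) ≡ R (decode fuel k a) (decode fuel (suc (suc k)) d)
byTag-R fuel k a d rewrite unpair-pair a d = refl

byTag-M : ∀ fuel k r → byTag fuel k 6 r ≡ M (decode fuel (suc k) r)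
byTag-M fuel zero    r = refl
byTag-M fuel (suc k) r = refl

toFin-toℕ : ∀ k (i : Fin (suc k)) → toFin k (toℕ i) ≡ i
toFin-toℕ zero    Fin.zero    = refl
toFin-toℕ (suc k) Fin.zero    = refl
toFin-toℕ (suc k) (Fin.suc i) = cong Fin.suc (toFin-toℕ k i)

fuel-for-tagged : ∀ {t r fuel} → pair (suc t) r ≤ fuel → Σ ℕ λ fuel′ → fuel ≡ suc fuel′ × r ≤ fuel′
fuel-for-tagged {t} {r} {suc fuel′} le = fuel′ , refl , ≤-pred (≤-trans (snd<pair-suc t r) le)
fuel-for-tagged {t} {r} {zero}      le with ≤-trans (snd<pair-suc t r) le
... | ()

mutual
  decode-encode : ∀ {k} (c : Code k) fuel → encode c ≤ fuel → decode fuel k (encode c) ≡ c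
  decode-encode Z zero       _ = refl
  decode-encode Z (suc fuel) _ = refl
  decode-encode S _ le with fuel-for-tagged {0} le
  ... | fuel , refl , _ = decode-pair fuel 1 1 0
  decode-encode {suc k} (P i) _ le with fuel-for-tagged {1} le
  ... | fuel , refl , _ = trans (decode-pair fuel (suc k) 2 (toℕ i)) (cong P (toFin-toℕ k i))
  decode-encode O _ le with fuel-for-tagged {2} le
  ... | fuel , refl , _ = decode-pair fuel 1 3 0
  decode-encode {k} (C {m = m} f hs) _ le with fuel-for-tagged {3} le
  ... | fuel , refl , r≤fuel =
    trans (decode-pair fuel k 4 _)
      (trans (byTag-C fuel k m (encode f) (encodeVec hs))
        (cong₂ C (decode-encode f fuel (≤-trans (fst≤pair _ _) args≤fuel))
                 (decodeVec-encodeVec hs fuel (≤-trans (snd≤pair _ _) args≤fuel))))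
    where args≤fuel = ≤-trans (snd≤pair m _) r≤fuel
  decode-encode {suc k} (R b s) _ le with fuel-for-tagged {4} le
  ... | fuel , refl , r≤fuel =
    trans (decode-pair fuel (suc k) 5 _)
      (trans (byTag-R fuel k (encode b) (encode s))
        (cong₂ R (decode-encode b fuel (≤-trans (fst≤pair _ _) r≤fuel))
                 (decode-encode s fuel (≤-trans (snd≤pair _ _) r≤fuel))))
  decode-encode {k} (M f) _ le with fuel-for-tagged {5} le
  ... | fuel , refl , r≤fuel =
    trans (decode-pair fuel k 6 _) (trans (byTag-M fuel k _) (cong M (decode-encode f fuel r≤fuel)))

  decodeVec-encodeVec : ∀ {k m} (hs : Vec (Code k) m) fuel → encodeVec hs ≤ fuel →
                        decodeVec fuel k m (encodeVec hs) ≡ hs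
  decodeVec-encodeVec []       fuel _  = refl
  decodeVec-encodeVec (h ∷ hs) fuel le =
    trans (decodeVec-pair fuel _ _ (encode h) (encodeVec hs))
      (cong₂ _∷_ (decode-encode h fuel (≤-trans (fst≤pair _ _) le))
                 (decodeVec-encodeVec hs fuel (≤-trans (snd≤pair _ _) le)))

code-encode : (c : Code 1) → code (encode c) ≡ c
code-encode c = decode-encode c (encode c) ≤-refl

Computes : Baire → Code 1 → Baire → Set
Computes g c φ = ∀ m → Eval g c (m ∷ []) (φ m)

Φ-encode : ∀ {g c φ} → Computes g c φ → Φ (encode c) g φ
Φ-encode {g} {c} {φ} c⇓φ m = subst (λ c → Eval g c (m ∷ []) (φ m)) (sym (code-encode c)) (c⇓φ m)

mutual
  Eval-resp-≈ : ∀ {g g′ k} {c : Code k} {xs y} → g ≈ g′ → Eval g c xs y → Eval g′ c xs y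
  Eval-resp-≈ g≈g′ ev-Z               = ev-Z
  Eval-resp-≈ g≈g′ ev-S               = ev-S
  Eval-resp-≈ g≈g′ ev-P               = ev-P
  Eval-resp-≈ {g′ = g′} g≈g′ (ev-O {x}) = subst (Eval g′ O (x ∷ [])) (sym (g≈g′ x)) ev-O
  Eval-resp-≈ g≈g′ (ev-C hs f)        = ev-C (EvalVec-resp-≈ g≈g′ hs) (Eval-resp-≈ g≈g′ f)
  Eval-resp-≈ g≈g′ (ev-R0 b)          = ev-R0 (Eval-resp-≈ g≈g′ b)
  Eval-resp-≈ g≈g′ (ev-RS r s)        = ev-RS (Eval-resp-≈ g≈g′ r) (Eval-resp-≈ g≈g′ s)
  Eval-resp-≈ g≈g′ (ev-M z nz)        =
    ev-M (Eval-resp-≈ g≈g′ z) (λ i i<y → proj₁ (nz i i<y) , Eval-resp-≈ g≈g′ (proj₂ (nz i i<y)))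

  EvalVec-resp-≈ : ∀ {g g′ k m} {hs : Vec (Code k) m} {xs ys} →
                   g ≈ g′ → EvalVec g hs xs ys → EvalVec g′ hs xs ys
  EvalVec-resp-≈ g≈g′ ev-[]       = ev-[]
  EvalVec-resp-≈ g≈g′ (ev-∷ h hs) = ev-∷ (Eval-resp-≈ g≈g′ h) (EvalVec-resp-≈ g≈g′ hs)

≈⇒≤T : ∀ {f g} → f ≈ g → f ≤T g
≈⇒≤T f≈g = encode O , Φ-encode (λ m → subst (Eval _ O (m ∷ [])) (sym (f≈g m)) ev-O)

≤T⇒≤M-Single : ∀ {𝒞 : MassProblem} {f g} → 𝒞 g → g ≤T f → 𝒞 ≤M Single f
≤T⇒≤M-Single {g = g} g∈𝒞 (e , Φef≡g) =
  e , λ f′ f′≈f → g , (λ m → Eval-resp-≈ (sym ∘ f′≈f) (Φef≡g m)) , g∈𝒞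

ifZero : ℕ → ℕ → ℕ → ℕ
ifZero zero    x y = x
ifZero (suc _) x y = y

ifZero-elim : (A : Baire → Set) (t : ℕ) {a b : Baire} →
  (t ≡ 0 → A a) → (t ≢ 0 → A b) → A (λ m → ifZero t (a m) (b m))
ifZero-elim A zero    zero⇒a _      = zero⇒a refl
ifZero-elim A (suc t) _      suc⇒b = suc⇒b (λ ())

∸-+-∸≡∣-∣ : ∀ m n → (m ∸ n) + (n ∸ m) ≡ ∣ m - n ∣
∸-+-∸≡∣-∣ zero    zero    = refl
∸-+-∸≡∣-∣ zero    (suc n) = refl
∸-+-∸≡∣-∣ (suc m) zero    = +-identityʳ (suc m)
∸-+-∸≡∣-∣ (suc m) (suc n) = ∸-+-∸≡∣-∣ m n

mismatch : ∀ {n} → Baire → Baire → (Fin n → ℕ) → ℕ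
mismatch {zero}  h v xs = 0
mismatch {suc n} h v xs = ∣ h (xs Fin.zero) - v (xs Fin.zero) ∣ + mismatch h v (xs ∘ Fin.suc)

mismatch-≈ : ∀ {n h v} (xs : Fin n → ℕ) → h ≈ v → mismatch h v xs ≡ 0
mismatch-≈ {zero}  xs h≈v = refl
mismatch-≈ {suc n} xs h≈v
  rewrite m≡n⇒∣m-n∣≡0 (h≈v (xs Fin.zero)) = mismatch-≈ (xs ∘ Fin.suc) h≈v

mismatch≡0⇒agree : ∀ {n h v} (xs : Fin n → ℕ) →
                   mismatch h v xs ≡ 0 → ∀ k → h (xs k) ≡ v (xs k)
mismatch≡0⇒agree xs eq Fin.zero    = ∣m-n∣≡0⇒m≡n (m+n≡0⇒m≡0 _ eq)
mismatch≡0⇒agree xs eq (Fin.suc k) = mismatch≡0⇒agree (xs ∘ Fin.suc) (m+n≡0⇒n≡0 _ eq) k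

constC : ∀ {k} → ℕ → Code k
constC zero    = Z
constC (suc n) = C S (constC n ∷ [])

predC : Code 1
predC = R Z (P Fin.zero)

flip∸C : Code 2
flip∸C = R (P Fin.zero) (C predC (P (Fin.suc Fin.zero) ∷ []))

+C : Code 2
+C = R (P Fin.zero) (C S (P (Fin.suc Fin.zero) ∷ []))

∣-∣C : Code 2
∣-∣C = C +C (C flip∸C (P (Fin.suc Fin.zero) ∷ P Fin.zero ∷ [])
          ∷ C flip∸C (P Fin.zero ∷ P (Fin.suc Fin.zero) ∷ []) ∷ [])

ifZeroC : Code 3
ifZeroC = R (P Fin.zero) (P (Fin.suc (Fin.suc (Fin.suc Fin.zero))))

apply₂ : Code 2 → Code 1 → Code 1 → Code 1
apply₂ op c d = C op (c ∷ d ∷ [])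

atC : Code 1 → ℕ → Code 1
atC c x = C c (constC x ∷ [])

prependC : ℕ → Code 1 → Code 1
prependC a c = R (constC a) (C c (P Fin.zero ∷ []))

mismatchC : ∀ {n} → Code 1 → Baire → (Fin n → ℕ) → Code 1
mismatchC {zero}  c v xs = Z
mismatchC {suc n} c v xs =
  apply₂ +C (apply₂ ∣-∣C (atC c (xs Fin.zero)) (constC (v (xs Fin.zero))))
            (mismatchC c v (xs ∘ Fin.suc))

module _ {g : Baire} where

  eval-const : ∀ {k} n {xs : Vec ℕ k} → Eval g (constC n) xs n
  eval-const zero    = ev-Z
  eval-const (suc n) = ev-C (ev-∷ (eval-const n) ev-[]) ev-S

  eval-pred : ∀ n → Eval g predC (n ∷ []) (pred n)
  eval-pred zero    = ev-R0 ev-Z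
  eval-pred (suc n) = ev-RS (eval-pred n) ev-P

  eval-flip∸ : ∀ n m → Eval g flip∸C (n ∷ m ∷ []) (m ∸ n)
  eval-flip∸ zero    m = ev-R0 ev-P
  eval-flip∸ (suc n) m = subst (Eval g flip∸C (suc n ∷ m ∷ [])) (pred[m∸n]≡m∸[1+n] m n)
    (ev-RS (eval-flip∸ n m) (ev-C (ev-∷ ev-P ev-[]) (eval-pred (m ∸ n))))

  eval-+ : ∀ m n → Eval g +C (m ∷ n ∷ []) (m + n)
  eval-+ zero    n = ev-R0 ev-P
  eval-+ (suc m) n = ev-RS (eval-+ m n) (ev-C (ev-∷ ev-P ev-[]) ev-S)

  eval-∣-∣ : ∀ m n → Eval g ∣-∣C (m ∷ n ∷ []) ∣ m - n ∣
  eval-∣-∣ m n = subst (Eval g ∣-∣C (m ∷ n ∷ [])) (∸-+-∸≡∣-∣ m n)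
    (ev-C (ev-∷ (ev-C (ev-∷ ev-P (ev-∷ ev-P ev-[])) (eval-flip∸ n m))
          (ev-∷ (ev-C (ev-∷ ev-P (ev-∷ ev-P ev-[])) (eval-flip∸ m n)) ev-[]))
          (eval-+ (m ∸ n) (n ∸ m)))

  eval-ifZero : ∀ t x y → Eval g ifZeroC (t ∷ x ∷ y ∷ []) (ifZero t x y)
  eval-ifZero zero    x y = ev-R0 ev-P
  eval-ifZero (suc t) x y = ev-RS (eval-ifZero t x y) ev-P

  computes-O : Computes g O g
  computes-O m = ev-O

  computes-apply₂ : ∀ {op c d φ ψ} {_∙_ : ℕ → ℕ → ℕ} →
    (∀ m n → Eval g op (m ∷ n ∷ []) (m ∙ n)) →
    Computes g c φ → Computes g d ψ → Computes g (apply₂ op c d) (λ m → φ m ∙ ψ m)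
  computes-apply₂ op⇓ c⇓φ d⇓ψ m = ev-C (ev-∷ (c⇓φ m) (ev-∷ (d⇓ψ m) ev-[])) (op⇓ _ _)

  computes-at : ∀ {c φ} x → Computes g c φ → Computes g (atC c x) (λ _ → φ x)
  computes-at x c⇓φ m = ev-C (ev-∷ (eval-const x) ev-[]) (c⇓φ x)

  computes-ifZero : ∀ {t a b τ φ ψ} → Computes g t τ → Computes g a φ → Computes g b ψ →
    Computes g (C ifZeroC (t ∷ a ∷ b ∷ [])) (λ m → ifZero (τ m) (φ m) (ψ m))
  computes-ifZero t⇓τ a⇓φ b⇓ψ m =
    ev-C (ev-∷ (t⇓τ m) (ev-∷ (a⇓φ m) (ev-∷ (b⇓ψ m) ev-[]))) (eval-ifZero _ _ _)

  computes-prepend : ∀ {c φ} a → Computes g c φ → Computes g (prependC a c) (a ⌢ φ)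
  computes-prepend a c⇓φ zero    = ev-R0 (eval-const a)
  computes-prepend a c⇓φ (suc m) =
    ev-RS (computes-prepend a c⇓φ m) (ev-C (ev-∷ ev-P ev-[]) (c⇓φ m))

  computes-mismatch : ∀ {n c h} v (xs : Fin n → ℕ) → Computes g c h →
    Computes g (mismatchC c v xs) (λ _ → mismatch h v xs)
  computes-mismatch {zero}  v xs c⇓h m = ev-Z
  computes-mismatch {suc n} v xs c⇓h =
    computes-apply₂ eval-+
      (computes-apply₂ eval-∣-∣ (computes-at (xs Fin.zero) c⇓h) (λ _ → eval-const (v (xs Fin.zero))))
      (computes-mismatch v (xs ∘ Fin.suc) c⇓h)

separatingPoint : ExcludedMiddle 0ℓ → (u w : Baire) → Σ ℕ λ x → ¬ (u ≈ w) → u x ≢ w x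
separatingPoint em u w with em {Σ ℕ λ x → u x ≢ w x}
... | yes (x , ux≢wx) = x , λ _ → ux≢wx
... | no ∄x = 0 , λ u≉w → ⊥-elim (u≉w λ x →
  decidable-stable (u x ≟ℕ w x) (λ ux≢wx → ∄x (x , ux≢wx)))

module JumpSplitter {n} (f : Fin n → Baire) (i : Fin n) (e : ℕ) (points : Fin n → ℕ)
  (separates : ∀ k → k ≢ i → f i (points k) ≢ f k (points k)) where

  splitterC : Code 1
  splitterC = C ifZeroC (mismatchC (code e) (f i) points
                         ∷ prependC 0 (prependC e O)
                         ∷ prependC 1 (code e) ∷ [])

  split : Baire → Baire → Baire
  split g h m = ifZero (mismatch h (f i) points) ((0 ⌢ (e ⌢ g)) m) ((1 ⌢ h) m)

  computes-split : ∀ {g h} → Φ e g h → Computes g splitterC (split g h)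
  computes-split Φeg≡h = computes-ifZero (computes-mismatch (f i) points Φeg≡h)
    (computes-prepend 0 (computes-prepend e computes-O)) (computes-prepend 1 Φeg≡h)

  mismatch≡0⇒index : ∀ {h k} → h ≈ f k → mismatch h (f i) points ≡ 0 → k ≡ i
  mismatch≡0⇒index {h} {k} h≈fk eq = decidable-stable (k ≟ i)
    (λ k≢i → separates k k≢i (trans (sym (mismatch≡0⇒agree points eq k)) (h≈fk (points k))))

  split-lands : ∀ {g h k} → ¬ (g ≤T f i) → Φ e g h → h ≈ f k →
                (Jump (f i) ×M Others f i) (split g h)
  split-lands {g} {h} {k} g≰fi Φeg≡h h≈fk =
    ifZero-elim (Jump (f i) ×M Others f i) (mismatch h (f i) points) {0 ⌢ (e ⌢ g)} {1 ⌢ h}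
      (λ eq → inj₁ (refl , jump (Φeg≡fi eq)))
      (λ neq → inj₂ (refl , k , (λ { refl → neq (mismatch-≈ points h≈fk) }) , h≈fk))
    where
    Φeg≡fi : mismatch h (f i) points ≡ 0 → Φ e g (f i)
    Φeg≡fi eq m = subst (Eval g (code e) (m ∷ []))
                        (subst (λ j → h ≈ f j) (mismatch≡0⇒index h≈fk eq) h≈fk m) (Φeg≡h m)

    jump : Φ e g (f i) → Jump (f i) (e ⌢ g)
    jump Φeg≡fi = ((e , Φeg≡fi) , g≰fi) , Φeg≡fi

lemma2p7 : ExcludedMiddle 0ℓ →
    (n : ℕ) → 1 ≤ n → (f : Fin n → Baire) →
    (∀ i j → i ≢ j → ¬ (f i ≤T f j)) →
    (C : MassProblem) → FinSet f ≤M C →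
    (i : Fin n) → ¬ ((Jump (f i) ×M Others f i) ≤M C) →
    C ≤M Single (f i)
lemma2p7 em n _ f incomparable 𝒞 (e , 𝒞→f) i 𝒞↛jump with em {𝒞 ≤M Single (f i)}
... | yes 𝒞≤fi = 𝒞≤fi
... | no 𝒞≰fi = ⊥-elim (𝒞↛jump (encode splitterC , reduce))
  where
  points : Fin n → ℕ
  points k = proj₁ (separatingPoint em (f i) (f k))

  separates : ∀ k → k ≢ i → f i (points k) ≢ f k (points k)
  separates k k≢i = proj₂ (separatingPoint em (f i) (f k)) (incomparable i k (k≢i ∘ sym) ∘ ≈⇒≤T)

  open JumpSplitter f i e points separates

  reduce : ∀ g → 𝒞 g → Σ Baire λ H → Φ (encode splitterC) g H × (Jump (f i) ×M Others f i) H
  reduce g g∈𝒞 with 𝒞→f g g∈𝒞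
  ... | h , Φeg≡h , k , h≈fk =
    split g h , Φ-encode (computes-split Φeg≡h)
              , split-lands (𝒞≰fi ∘ ≤T⇒≤M-Single g∈𝒞) Φeg≡h h≈fk
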